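{- Let $r$ be a positive integer and $\alpha$ a positive real number. For any $\beta\in\mathscr{W}_r(\alpha)$, the set $\mathscr{T}_{r,\alpha}(\beta)$ is non-empty.
   Context: For $s\in\mathbb{N}^+$, $[s]=\{1,\dots,s\}$. For a positive integer $r$ and positive real $\alpha$, $\mathscr{W}_r(\alpha)$ is the smallest set of non-negative real numbers such that: (1) $\alpha\in\mathscr{W}_r(\alpha)$; and (2) for any $s\in\mathbb{N}^+$ and any multi-set $\{q_i: i\in[s]\}$ of positive elements of $\mathscr{W}_r(\alpha)$, if $\beta:=\alpha-\sum_{i=1}^s q_i^{ -1}\ge 0$ and $1\le s\le r-\lceil \beta/(\beta+1)\rceil$, then $\beta\in\mathscr{W}_r(\alpha)$. $\mathscr{T}_{r,\alpha}$ is the set of ordered pairs $(T,\omega)$ where $T$ is a directed tree (an orientation of a tree) with a unique source $z$, and $\omega:V(T)\to\mathscr{W}_r(\alpha)$, such that for every $v\in V(T)$, writing $N^+_T(v)$ for the set of out-neighbours of $v$ and $od_T(v)=|N^+_T(v)|$: (1) $od_T(v)\le r$ if $v=z$ and $\omega(z)=0$, and $od_T(v)\le r-1$ otherwise; (2) $\omega(v)>0$ whenever $v\ne z$, and $\omega(v)=\alpha$ if $N^+_T(v)=\emptyset$, while $\omega(v)=\alpha-\sum_{u\in N^+_T(v)}\omega(u)^{ -1}$ otherwise. For $\beta\ge 0$, $\mathscr{T}_{r,\alpha}(\beta)$ is the set of $(T,\omega)\in\mathscr{T}_{r,\alpha}$ with $\omega(z)=\beta$, $z$ the unique source of $T$.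 -}

module Defs where

open import Level using (0ℓ)
open import Algebra.Bundles using (CommutativeRing)
open import Relation.Binary.Core using (Rel)
open import Relation.Binary.Structures using (IsStrictTotalOrder)
open import Relation.Nullary using (¬_)
open import Data.Nat as ℕ using (ℕ; zero; suc)
open import Data.Integer as ℤ using (ℤ; +_; -[1+_])
open import Data.List using (List; []; _∷_; length; map)
open import Data.List.Relation.Unary.All using (All)
open import Data.Product using (_×_; Σ)
open import Data.Sum using (_⊎_)
open import Data.Bool using (Bool; true; false)
open import Data.Unit using (⊤)
open import Relation.Binary.PropositionalEquality using (_≡_)

-- An ordered field (the real numbers are an instance).  The inverse is
-- made total (with 0⁻¹ = 0); it is only ever applied to positive elements.
record OrderedField : Set₁ where
  field
    commutativeRing : CommutativeRing 0ℓ 0ℓ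
  open CommutativeRing commutativeRing public
  infix 4 _<_
  infix 8 _⁻¹
  field
    _⁻¹      : Carrier → Carrier
    ⁻¹-cong  : ∀ {x y} → x ≈ y → x ⁻¹ ≈ y ⁻¹
    0≉1      : ¬ (0# ≈ 1#)
    inverseʳ : ∀ {x} → ¬ (x ≈ 0#) → x * (x ⁻¹) ≈ 1#
    inv-zero : 0# ⁻¹ ≈ 0#
    _<_      : Rel Carrier 0ℓ
    <-isStrictTotalOrder : IsStrictTotalOrder _≈_ _<_
    +-mono-< : ∀ {x y z} → x < y → x + z < y + z
    *-pos    : ∀ {x y} → 0# < x → 0# < y → 0# < x * y

  infix 4 _≤_
  _≤_ : Rel Carrier 0ℓ
  x ≤ y = x < y ⊎ x ≈ y

  fromℕ : ℕ → Carrier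
  fromℕ zero    = 0#
  fromℕ (suc n) = 1# + fromℕ n

  fromℤ : ℤ → Carrier
  fromℤ (+ n)     = fromℕ n
  fromℤ -[1+ n ]  = - fromℕ (suc n)

  IsCeiling : Carrier → ℤ → Set
  IsCeiling x c = (fromℤ (c ℤ.- ℤ.1ℤ) < x) × (x ≤ fromℤ c)

  sumInv : List Carrier → Carrier
  sumInv []       = 0#
  sumInv (q ∷ qs) = q ⁻¹ + sumInv qs

module _ (F : OrderedField) (r : ℕ) (α : OrderedField.Carrier F) where
  open OrderedField F

  -- 𝒲_r(α): the smallest set containing α and closed under rule (2).
  -- The multiset {q_i : i ∈ [s]} is represented by a list qs of length s.
  data InW : Carrier → Set where
    base : InW α
    step : (qs : List Carrier) → All InW qs → All (0# <_) qs →
           (β : Carrier) → β ≈ α - sumInv qs → 0# ≤ β →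
           (c : ℤ) → IsCeiling (β * ((β + 1#) ⁻¹)) c →
           1 ℕ.≤ length qs → + length qs ℤ.≤ + r ℤ.- c →
           InW β

-- Directed trees with a unique source z are exactly out-arborescences
-- rooted at z; we encode them as rose trees (root = z, the children of
-- a vertex = its out-neighbours), each vertex carrying its weight ω(v).
data WTree (A : Set) : Set where
  node : A → List (WTree A) → WTree A

weight : ∀ {A} → WTree A → A
weight (node w _) = w

children : ∀ {A} → WTree A → List (WTree A)
children (node _ ts) = ts

module _ (F : OrderedField) (r : ℕ) (α : OrderedField.Carrier F) where
  open OrderedField F

  -- conditions (1),(2) and ω(v) ∈ 𝒲_r(α) at every vertex;
  -- isRoot records whether the vertex is the source z.
  mutual
    Good : Bool → WTree Carrier → Set
    Good isRoot (node w ts) =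
        InW F r α w
      × ((isRoot ≡ true × w ≈ 0#) → length ts ℕ.≤ r)
      × (¬ (isRoot ≡ true × w ≈ 0#) → length ts ℕ.≤ r ℕ.∸ 1)
      × (isRoot ≡ false → 0# < w)
      × (ts ≡ [] → w ≈ α)
      × (¬ (ts ≡ []) → w ≈ α - sumInv (map weight ts))
      × AllGood ts

    AllGood : List (WTree Carrier) → Set
    AllGood []       = ⊤
    AllGood (t ∷ ts) = Good false t × AllGood ts

  InT : Carrier → WTree Carrier → Set
  InT β t = Good true t × weight t ≈ β

-- For β = α − Σ qᵢ⁻¹ obtained by rule (2), hang below a new source of weight β
-- the trees built for the qᵢ; their sources become ordinary vertices, which is
-- allowed because each qᵢ > 0.  The out-degree of the new source is s, and
-- s ≤ r − ⌈β/(β+1)⌉ is exactly condition (1): the ceiling is 0 when β = 0 and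
-- at least 1 when β > 0.
module Submission where

open import Defs
open import Data.Nat using (ℕ; _≤_)
open import Data.Product using (Σ)

open import Data.Nat as ℕ using (zero; suc; _∸_; z≤n)
import Data.Nat.Properties as ℕ
open import Data.Integer as ℤ using (+_; -[1+_])
import Data.Integer.Properties as ℤ
open import Data.List using (List; []; _∷_; length; map)
open import Data.List.Properties using (length-map)
open import Data.List.Relation.Unary.All using (All; []; _∷_)
open import Data.Product using (_×_; _,_)
open import Data.Sum using (inj₁; inj₂)
open import Data.Bool using (true; false)
open import Data.Unit using (tt)
open import Data.Empty using (⊥-elim)
open import Relation.Nullary using (¬_)
open import Relation.Binary using (tri<; tri≈; tri>)
open import Relation.Binary.Structures using (IsStrictTotalOrder)
open import Relation.Binary.PropositionalEquality as ≡ using (_≡_)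
import Relation.Binary.Construct.StrictToNonStrict as StrictToNonStrict
import Algebra.Properties.Ring as RingProperties

i≤j-k⇒i+k≤j : ∀ {i j k} → i ℤ.≤ j ℤ.- k → i ℤ.+ k ℤ.≤ j
i≤j-k⇒i+k≤j {i} {j} {k} i≤j-k = begin
  i ℤ.+ k              ≤⟨ ℤ.+-monoˡ-≤ k i≤j-k ⟩
  j ℤ.- k ℤ.+ k        ≡⟨ ℤ.+-assoc j (ℤ.- k) k ⟩
  j ℤ.+ (ℤ.- k ℤ.+ k)  ≡⟨ ≡.cong (λ x → j ℤ.+ x) (ℤ.+-inverseˡ k) ⟩
  j ℤ.+ ℤ.0ℤ           ≡⟨ ℤ.+-identityʳ j ⟩
  j                    ∎
  where open ℤ.≤-Reasoning

s≤r-c⇒k≤c⇒s≤r∸k : ∀ {s r k c} → + s ℤ.≤ + r ℤ.- c → + k ℤ.≤ c → s ≤ r ∸ k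
s≤r-c⇒k≤c⇒s≤r∸k {s} {r} {k} {c} s≤r-c k≤c = ℕ.m+n≤o⇒m≤o∸n s (ℤ.drop‿+≤+ (begin
  + s ℤ.+ + k  ≤⟨ ℤ.+-monoʳ-≤ (+ s) k≤c ⟩
  + s ℤ.+ c    ≤⟨ i≤j-k⇒i+k≤j {k = c} s≤r-c ⟩
  + r          ∎))
  where open ℤ.≤-Reasoning

module OrderedFieldProperties (F : OrderedField) where
  open OrderedField F renaming (_≤_ to _≤ᶠ_)
  open IsStrictTotalOrder <-isStrictTotalOrder
    using (irrefl; asym; compare; <-respˡ-≈; <-respʳ-≈; <-resp-≈)
    renaming (trans to <-trans)
  open RingProperties ring using (-1*x≈-x; -‿involutive; -‿distribʳ-*)
  open StrictToNonStrict _≈_ _<_ using (<-≤-trans)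
  open import Relation.Binary.Reasoning.Setoid setoid

  ≤-trans : ∀ {x y z} → x ≤ᶠ y → y ≤ᶠ z → x ≤ᶠ z
  ≤-trans = StrictToNonStrict.trans _≈_ _<_ isEquivalence <-resp-≈ <-trans

  0<x⇒-x<0 : ∀ {x} → 0# < x → - x < 0#
  0<x⇒-x<0 {x} 0<x = <-respˡ-≈ (+-identityˡ (- x)) (<-respʳ-≈ (-‿inverseʳ x) (+-mono-< 0<x))

  x<0⇒0<-x : ∀ {x} → x < 0# → 0# < - x
  x<0⇒0<-x {x} x<0 = <-respʳ-≈ (+-identityˡ (- x)) (<-respˡ-≈ (-‿inverseʳ x) (+-mono-< x<0))

  -- If 1 < 0 then 0 < -1, hence 0 < (-1)(-1) = 1.
  0<1 : 0# < 1#
  0<1 with compare 0# 1#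
  ... | tri< 0<1 _ _ = 0<1
  ... | tri≈ _ 0≈1 _ = ⊥-elim (0≉1 0≈1)
  ... | tri> _ _ 1<0 = ⊥-elim (asym 1<0 (<-respʳ-≈ [-1][-1]≈1 (*-pos 0<-1 0<-1)))
    where
      0<-1 : 0# < - 1#
      0<-1 = x<0⇒0<-x 1<0
      [-1][-1]≈1 : - 1# * - 1# ≈ 1#
      [-1][-1]≈1 = trans (-1*x≈-x (- 1#)) (-‿involutive 1#)

  0<x⇒0≤y⇒0<x+y : ∀ {x y} → 0# < x → 0# ≤ᶠ y → 0# < x + y
  0<x⇒0≤y⇒0<x+y {x} {y} 0<x (inj₁ 0<y) =
    <-trans 0<x (<-respˡ-≈ (+-identityˡ x) (<-respʳ-≈ (+-comm y x) (+-mono-< 0<y)))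
  0<x⇒0≤y⇒0<x+y {x} {y} 0<x (inj₂ 0≈y) =
    <-respʳ-≈ (trans (sym (+-identityʳ x)) (+-congˡ 0≈y)) 0<x

  0≤x⇒0<y⇒0≤x*y : ∀ {x y} → 0# ≤ᶠ x → 0# < y → 0# ≤ᶠ x * y
  0≤x⇒0<y⇒0≤x*y (inj₁ 0<x) 0<y = inj₁ (*-pos 0<x 0<y)
  0≤x⇒0<y⇒0≤x*y {x} {y} (inj₂ 0≈x) _ = inj₂ (sym (trans (*-congʳ (sym 0≈x)) (zeroˡ y)))

  0≤x⇒x≉0⇒0<x : ∀ {x} → 0# ≤ᶠ x → ¬ (x ≈ 0#) → 0# < x
  0≤x⇒x≉0⇒0<x (inj₁ 0<x) _   = 0<x
  0≤x⇒x≉0⇒0<x (inj₂ 0≈x) x≉0 = ⊥-elim (x≉0 (sym 0≈x))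

  0<x⇒x≉0 : ∀ {x} → 0# < x → ¬ (x ≈ 0#)
  0<x⇒x≉0 0<x x≈0 = irrefl (sym x≈0) 0<x

  0<x⇒0<x⁻¹ : ∀ {x} → 0# < x → 0# < x ⁻¹
  0<x⇒0<x⁻¹ {x} 0<x with compare 0# (x ⁻¹)
  ... | tri< 0<x⁻¹ _ _ = 0<x⁻¹
  ... | tri≈ _ 0≈x⁻¹ _ = ⊥-elim (0≉1 (begin
    0#         ≈⟨ zeroʳ x ⟨
    x * 0#     ≈⟨ *-congˡ 0≈x⁻¹ ⟩
    x * x ⁻¹   ≈⟨ inverseʳ (0<x⇒x≉0 0<x) ⟩
    1#         ∎))
  ... | tri> _ _ x⁻¹<0 = ⊥-elim (asym (0<x⇒-x<0 0<1) (<-respʳ-≈ x[-x⁻¹]≈-1 (*-pos 0<x (x<0⇒0<-x x⁻¹<0))))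
    where
      x[-x⁻¹]≈-1 : x * - (x ⁻¹) ≈ - 1#
      x[-x⁻¹]≈-1 = trans (sym (-‿distribʳ-* x (x ⁻¹))) (-‿cong (inverseʳ (0<x⇒x≉0 0<x)))

  0≤x⇒0<[x+1]⁻¹ : ∀ {x} → 0# ≤ᶠ x → 0# < (x + 1#) ⁻¹
  0≤x⇒0<[x+1]⁻¹ {x} 0≤x = 0<x⇒0<x⁻¹ (<-respʳ-≈ (+-comm 1# x) (0<x⇒0≤y⇒0<x+y 0<1 0≤x))

  0≤fromℕ : ∀ n → 0# ≤ᶠ fromℕ n
  0≤fromℕ zero    = inj₂ refl
  0≤fromℕ (suc n) = inj₁ (0<x⇒0≤y⇒0<x+y 0<1 (0≤fromℕ n))

  fromℤ-[1+n]<0 : ∀ n → fromℤ -[1+ n ] < 0#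
  fromℤ-[1+n]<0 n = 0<x⇒-x<0 (0<x⇒0≤y⇒0<x+y 0<1 (0≤fromℕ n))

  0≤fromℤ⇒0≤ : ∀ {c} → 0# ≤ᶠ fromℤ c → + 0 ℤ.≤ c
  0≤fromℤ⇒0≤ {+ n}      _           = ℤ.+≤+ z≤n
  0≤fromℤ⇒0≤ { -[1+ n ]} (inj₁ 0<c) = ⊥-elim (asym 0<c (fromℤ-[1+n]<0 n))
  0≤fromℤ⇒0≤ { -[1+ n ]} (inj₂ 0≈c) = ⊥-elim (irrefl (sym 0≈c) (fromℤ-[1+n]<0 n))

  0<fromℤ⇒1≤ : ∀ {c} → 0# < fromℤ c → + 1 ℤ.≤ c
  0<fromℤ⇒1≤ {+ zero}    0<0 = ⊥-elim (irrefl refl 0<0)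
  0<fromℤ⇒1≤ {+ suc n}   _   = ℤ.+≤+ (ℕ.s≤s z≤n)
  0<fromℤ⇒1≤ { -[1+ n ]} 0<c = ⊥-elim (asym 0<c (fromℤ-[1+n]<0 n))

  IsCeiling⇒0≤ : ∀ {x c} → 0# ≤ᶠ x → IsCeiling x c → + 0 ℤ.≤ c
  IsCeiling⇒0≤ 0≤x (_ , x≤c) = 0≤fromℤ⇒0≤ (≤-trans 0≤x x≤c)

  IsCeiling⇒1≤ : ∀ {x c} → 0# < x → IsCeiling x c → + 1 ℤ.≤ c
  IsCeiling⇒1≤ 0<x (_ , x≤c) = 0<fromℤ⇒1≤ (<-≤-trans <-trans <-respʳ-≈ 0<x x≤c)

module Construction (F : OrderedField) (r : ℕ) (α : OrderedField.Carrier F) where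
  open OrderedField F renaming (_≤_ to _≤ᶠ_)
  open OrderedFieldProperties F

  mutual
    tree : ∀ {β} → InW F r α β → WTree Carrier
    tree base                         = node α []
    tree (step _ ws _ β _ _ _ _ _ _) = node β (forest ws)

    forest : ∀ {qs} → All (InW F r α) qs → List (WTree Carrier)
    forest []       = []
    forest (w ∷ ws) = tree w ∷ forest ws

  weight-tree : ∀ {β} (w : InW F r α β) → weight (tree w) ≡ β
  weight-tree base                         = ≡.refl
  weight-tree (step _ _ _ _ _ _ _ _ _ _) = ≡.refl

  weights-forest : ∀ {qs} (ws : All (InW F r α) qs) → map weight (forest ws) ≡ qs
  weights-forest []       = ≡.refl
  weights-forest (w ∷ ws) = ≡.cong₂ _∷_ (weight-tree w) (weights-forest ws)

  length-forest : ∀ {qs} (ws : All (InW F r α) qs) → length (forest ws) ≡ length qs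
  length-forest ws = ≡.trans (≡.sym (length-map weight (forest ws))) (≡.cong length (weights-forest ws))

  Good-true⇒Good-false : ∀ t → Good F r α true t → 0# < weight t → Good F r α false t
  Good-true⇒Good-false (node w ts) (w∈W , _ , deg , _ , leaf , inner , ts-good) 0<w =
    w∈W , (λ { (() , _) }) , (λ _ → deg λ { (_ , w≈0) → 0<x⇒x≉0 0<w w≈0 }) , (λ _ → 0<w)
        , leaf , inner , ts-good

  mutual
    tree-Good : ∀ {β} (w : InW F r α β) → Good F r α true (tree w)
    tree-Good base =
      base , (λ _ → z≤n) , (λ _ → z≤n) , (λ ()) , (λ _ → refl) , (λ []≢[] → ⊥-elim ([]≢[] ≡.refl)) , tt
    tree-Good β∈W@(step _ ws 0<qs β β≈α-Σqs⁻¹ 0≤β c ⌈β/[β+1]⌉≡c 1≤s s≤r-c) =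
      β∈W , (λ _ → deg≤r∸ (IsCeiling⇒0≤ 0≤β/[β+1] ⌈β/[β+1]⌉≡c)) , deg≤r-1 , (λ ())
        , forest≡[]⇒β≈α , (λ _ → β≈α-Σweights⁻¹) , forest-AllGood ws 0<qs
      where
        forest≡[]⇒β≈α : forest ws ≡ [] → β ≈ α
        forest≡[]⇒β≈α ws≡[] = ⊥-elim (ℕ.1+n≰n (≡.subst (1 ≤_) (≡.trans (≡.sym (length-forest ws)) (≡.cong length ws≡[])) 1≤s))

        β≈α-Σweights⁻¹ : β ≈ α - sumInv (map weight (forest ws))
        β≈α-Σweights⁻¹ = trans β≈α-Σqs⁻¹ (reflexive (≡.cong (λ ps → α - sumInv ps) (≡.sym (weights-forest ws))))

        0≤β/[β+1] : 0# ≤ᶠ β * (β + 1#) ⁻¹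
        0≤β/[β+1] = 0≤x⇒0<y⇒0≤x*y 0≤β (0≤x⇒0<[x+1]⁻¹ 0≤β)

        deg≤r∸ : ∀ {k} → + k ℤ.≤ c → length (forest ws) ≤ r ∸ k
        deg≤r∸ {k} k≤c = ≡.subst (_≤ r ∸ k) (≡.sym (length-forest ws)) (s≤r-c⇒k≤c⇒s≤r∸k s≤r-c k≤c)

        deg≤r-1 : ¬ (true ≡ true × β ≈ 0#) → length (forest ws) ≤ r ∸ 1
        deg≤r-1 β≉0 = deg≤r∸ (IsCeiling⇒1≤ (*-pos 0<β (0≤x⇒0<[x+1]⁻¹ 0≤β)) ⌈β/[β+1]⌉≡c)
          where 0<β = 0≤x⇒x≉0⇒0<x 0≤β (λ β≈0 → β≉0 (≡.refl , β≈0))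

    forest-AllGood : ∀ {qs} (ws : All (InW F r α) qs) → All (0# <_) qs → AllGood F r α (forest ws)
    forest-AllGood []       []          = tt
    forest-AllGood (w ∷ ws) (0<q ∷ 0<qs) =
      Good-true⇒Good-false (tree w) (tree-Good w) (≡.subst (0# <_) (≡.sym (weight-tree w)) 0<q)
        , forest-AllGood ws 0<qs

lemma3p1 : (F : OrderedField) (r : ℕ) → 1 ≤ r →
    (α : OrderedField.Carrier F) → OrderedField._<_ F (OrderedField.0# F) α →
    (β : OrderedField.Carrier F) → InW F r α β →
    Σ (WTree (OrderedField.Carrier F)) (λ t → InT F r α β t)
lemma3p1 F r _ α _ β w =
  tree w , tree-Good w , OrderedField.reflexive F (weight-tree w)
  where open Construction F r α
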